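{- Let $\Gamma$ be an infinite abelian group and $F\colon\Gamma\to\Gamma$ an injective endomorphism. Then (1) a finite union of $F$-EDP subsets of $\Gamma$ is $F$-EDP, and (2) every $F$-sparse subset of $\Gamma$ is $F$-EDP.
   Context: For a string $\sigma=s_0\cdots s_n$ of elements of $\Gamma$ and an endomorphism $G$, $[\sigma]_G=s_0+Gs_1+\cdots+G^ns_n$; $[L]_G=\{[\sigma]_G:\sigma\in L\}$. $\Lambda^*$ denotes finite strings over $\Lambda$. A finite $\Sigma\subseteq\Gamma$ is a $G$-spanning set if: (i) every $a\in\Gamma$ equals $[\sigma]_G$ for some $\sigma\in\Sigma^*$; (ii) $0\in\Sigma$ and $\Sigma=-\Sigma$; (iii) for $a_1,\dots,a_5\in\Sigma$, $a_1+\cdots+a_5\in\Sigma+G\Sigma$; (iv) if $a_1,a_2,a_3\in\Sigma$ and $a_1+a_2+a_3\in G\Gamma$ then $a_1+a_2+a_3\in G\Sigma$. A language is sparse if it is regular and the number of its words of length $\le x$ is bounded by a polynomial in $x$. $A$ is $F$-sparse if there are $r>0$, an $F^r$-spanning set $\Sigma$ and a sparse $L\subseteq\Sigma^*$ with $A=[L]_{F^r}$. $\mathbb{N}$ includes $0$. For a tuple $\mathbf{s}=(\sigma_1,\dots,\sigma_n)$ of strings over $\Gamma$ and $\mathbf{k}=(k_1,\dots,k_n)\in\mathbb{N}^n$, $\mathbf{s}^{\mathbf{k}}=\sigma_1^{k_1}\cdots\sigma_n^{k_n}$. A set is $F$-EDP if it has the form $\{[\mathbf{s}^{\mathbf{k}}]_F:(\mathbb{N},+)\models\phi(\mathbf{k})\}$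 for some tuple $\mathbf{s}$ of strings over $\Gamma$ and some first-order formula $\phi$ in the language of $(\mathbb{N},+)$ with $|\mathbf{s}|$ free variables. -}

module Defs where

open import Level using (Level; _⊔_) renaming (zero to lzero; suc to lsuc)
open import Algebra.Bundles using (AbelianGroup)
open import Algebra.Morphism.Structures using (module GroupMorphisms)
open import Data.Nat using (ℕ; zero; suc; _+_; _*_; _^_; _≤_; _<_)
open import Data.Fin using (Fin)
open import Data.List using (List; []; _∷_; _++_; map; concat; concatMap; replicate; filterᵇ; length; upTo; allFin)
open import Data.Nat.ListAction using (sum)
open import Data.List.Relation.Unary.All using (All)
open import Data.List.Relation.Unary.Any using (Any)
open import Data.Bool using (Bool; true)
open import Data.Product using (Σ; ∃; ∃-syntax; _×_; _,_)
open import Data.Sum using (_⊎_)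
open import Data.Empty using (⊥)
open import Relation.Nullary using (¬_)
open import Relation.Binary.PropositionalEquality using (_≡_)
open import Relation.Unary using (Pred)

-- First-order logic in the language of (ℕ, +), with n free variables
-- (de Bruijn style: a formula in context n has variables Fin n).

data Term (n : ℕ) : Set where
  var  : Fin n → Term n
  _⊕_  : Term n → Term n → Term n

data Formula : ℕ → Set where
  _≐_  : ∀ {n} → Term n → Term n → Formula n
  ~_   : ∀ {n} → Formula n → Formula n
  _∧'_ : ∀ {n} → Formula n → Formula n → Formula n
  _∨'_ : ∀ {n} → Formula n → Formula n → Formula n
  ∀'   : ∀ {n} → Formula (suc n) → Formula n
  ∃'   : ∀ {n} → Formula (suc n) → Formula n

extend : ∀ {n} → ℕ → (Fin n → ℕ) → Fin (suc n) → ℕ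
extend x ρ Fin.zero    = x
extend x ρ (Fin.suc i) = ρ i

evalTerm : ∀ {n} → (Fin n → ℕ) → Term n → ℕ
evalTerm ρ (var i) = ρ i
evalTerm ρ (t ⊕ u) = evalTerm ρ t + evalTerm ρ u

Sat : ∀ {n} → Formula n → (Fin n → ℕ) → Set
Sat (t ≐ u)   ρ = evalTerm ρ t ≡ evalTerm ρ u
Sat (~ φ)     ρ = ¬ Sat φ ρ
Sat (φ ∧' ψ)  ρ = Sat φ ρ × Sat ψ ρ
Sat (φ ∨' ψ)  ρ = Sat φ ρ ⊎ Sat ψ ρ
Sat (∀' φ)    ρ = (x : ℕ) → Sat φ (extend x ρ)
Sat (∃' φ)    ρ = Σ ℕ λ x → Sat φ (extend x ρ)

record DFA (k : ℕ) : Set where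
  field
    nStates : ℕ
    start   : Fin nStates
    δ       : Fin nStates → Fin k → Fin nStates
    final   : Fin nStates → Bool

run : ∀ {k} (M : DFA k) → Fin (DFA.nStates M) → List (Fin k) → Fin (DFA.nStates M)
run M q []       = q
run M q (a ∷ w)  = run M (DFA.δ M q a) w

acceptsᵇ : ∀ {k} → DFA k → List (Fin k) → Bool
acceptsᵇ M w = DFA.final M (run M (DFA.start M) w)

Accepts : ∀ {k} → DFA k → List (Fin k) → Set
Accepts M w = acceptsᵇ M w ≡ true

words : (k n : ℕ) → List (List (Fin k))
words k zero    = [] ∷ []
words k (suc n) = concatMap (λ i → map (i ∷_) (words k n)) (allFin k)

countUpTo : ∀ {k} → DFA k → ℕ → ℕ
countUpTo {k} M x = sum (map (λ n → length (filterᵇ (acceptsᵇ M) (words k n))) (upTo (suc x)))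

PolyBounded : ∀ {k} → DFA k → Set
PolyBounded M = ∃[ c ] ∃[ d ] ((x : ℕ) → countUpTo M x ≤ c * (suc x) ^ d)

-- Notions relative to an abelian group Γ (written additively in the paper;
-- the stdlib bundle uses _∙_, ε, _⁻¹ for +, 0, -).

iter : ∀ {a} {A : Set a} → (A → A) → ℕ → A → A
iter f zero    x = x
iter f (suc n) x = f (iter f n x)

module GroupDefs {c ℓ : Level} (G : AbelianGroup c ℓ) where
  open AbelianGroup G renaming (Carrier to Γ)
  open GroupMorphisms rawGroup rawGroup public using (IsGroupMonomorphism)

  Infinite : Set (c ⊔ ℓ)
  Infinite = (xs : List Γ) → ∃[ x ] ¬ Any (x ≈_) xs

  evalFrom : (Γ → Γ) → ℕ → List Γ → Γ
  evalFrom E i []      = ε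
  evalFrom E i (s ∷ σ) = iter E i s ∙ evalFrom E (suc i) σ

  ⟦_⟧[_] : List Γ → (Γ → Γ) → Γ
  ⟦ σ ⟧[ E ] = evalFrom E 0 σ

  -- a finite subset Σ of Γ, given by an enumeration Fin k → Γ
  _∈ₛ_ : ∀ {k} → Γ → (Fin k → Γ) → Set ℓ
  x ∈ₛ S = ∃[ i ] S i ≈ x

  record IsSpanning (E : Γ → Γ) {k : ℕ} (S : Fin k → Γ) : Set (c ⊔ ℓ) where
    field
      span    : (a : Γ) → ∃[ w ] ⟦ map S w ⟧[ E ] ≈ a
      zero∈   : ε ∈ₛ S
      neg⊆    : (a : Γ) → a ∈ₛ S → (a ⁻¹) ∈ₛ S
      ⊆neg    : (a : Γ) → a ∈ₛ S → ∃[ b ] (b ∈ₛ S × a ≈ b ⁻¹)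
      sum5    : (a₁ a₂ a₃ a₄ a₅ : Γ) → a₁ ∈ₛ S → a₂ ∈ₛ S → a₃ ∈ₛ S → a₄ ∈ₛ S → a₅ ∈ₛ S →
                ∃[ b ] ∃[ b' ] (b ∈ₛ S × b' ∈ₛ S × (a₁ ∙ a₂ ∙ a₃ ∙ a₄ ∙ a₅) ≈ b ∙ E b')
      sum3    : (a₁ a₂ a₃ : Γ) → a₁ ∈ₛ S → a₂ ∈ₛ S → a₃ ∈ₛ S →
                (∃[ g ] (a₁ ∙ a₂ ∙ a₃) ≈ E g) →
                ∃[ b ] (b ∈ₛ S × (a₁ ∙ a₂ ∙ a₃) ≈ E b)

  strPow : List Γ → ℕ → List Γ
  strPow σ m = concat (replicate m σ)

  tuplePow : ∀ {n} → (Fin n → List Γ) → (Fin n → ℕ) → List Γ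
  tuplePow {n} s k = concatMap (λ i → strPow (s i) (k i)) (allFin n)

  IsEDP : ∀ {p} → (Γ → Γ) → Pred Γ p → Set (c ⊔ ℓ ⊔ p)
  IsEDP F A = ∃[ n ] Σ (Fin n → List Γ) λ s → Σ (Formula n) λ φ →
              (a : Γ) → (A a → ∃[ k ] (Sat φ k × ⟦ tuplePow s k ⟧[ F ] ≈ a))
                      × (∃[ k ] (Sat φ k × ⟦ tuplePow s k ⟧[ F ] ≈ a) → A a)

  -- A is F-sparse: A = [L]_{F^r} for r > 0, an F^r-spanning set S and a
  -- sparse language L ⊆ S* (L given by a DFA over the index alphabet of S).
  IsSparseSet : ∀ {p} → (Γ → Γ) → Pred Γ p → Set (c ⊔ ℓ ⊔ p)
  IsSparseSet F A = ∃[ r ] (0 < r × ∃[ k ] Σ (Fin k → Γ) λ S →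
      IsSpanning (iter F r) S × Σ (DFA k) λ M → PolyBounded M ×
      ((a : Γ) → (A a → ∃[ w ] (Accepts M w × ⟦ map S w ⟧[ iter F r ] ≈ a))
               × (∃[ w ] (Accepts M w × ⟦ map S w ⟧[ iter F r ] ≈ a) → A a)))

  ⋃ : ∀ {p m} → (Fin m → Pred Γ p) → Pred Γ p
  ⋃ A x = ∃[ i ] A i x

{-# OPTIONS --safe #-}
module Submission where

-- A set is F-EDP iff it is the image, under σ ↦ [σ]_F, of a bounded language: the words
-- σ₁^k₁ ⋯ σₙ^kₙ whose exponent tuple satisfies a formula of (ℕ, +). These languages are closed
-- under finite unions, which gives (1), and under concatenation, σ* and homomorphic images.
-- For (2), take a DFA for the sparse language L. Two loops x, y at a useful state q commute, for
-- otherwise the 2^m words p b₁ ⋯ bₘ s with bᵢ ∈ {xy, yx} are distinct accepted words of length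
-- linear in m. Hence every loop at q is a power of the shortest one z_q, and cutting an accepted
-- word at its last return to each visited state writes it as z_q₀^e₀ a₁ z_q₁^e₁ ⋯ aₙ z_qₙ^eₙ with
-- n < #states: L is bounded. Finally [w]_{F^r} = [w′]_F, where w′ follows every letter by r − 1
-- zeros, so [L]_{F^r} is the image of the bounded language {w′ : w ∈ L}.

open import Defs
open import Level using (Level)
open import Algebra.Bundles using (AbelianGroup)
open import Algebra.Morphism.Structures using (module MonoidMorphisms)
import Algebra.Morphism.Construct.Identity as Identity
import Algebra.Morphism.Construct.Composition as Composition
open import Data.Nat using (ℕ; zero; suc; pred; _+_; _*_; _^_; _∸_; _≤_; _<_; z≤n; s≤s; _≤?_)
open import Data.Nat.Properties
  using ( ≤-refl; ≤-reflexive; ≤-trans; <-trans; ≤-<-trans; <-≤-trans; <-irrefl; <⇒≤; ≰⇒>; ≮⇒≥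
        ; n<1+n; n≤1+n; m≤n⇒m≤1+n; m<1+n⇒m≤n; m≤n⇒m<n∨m≡n; m≤m+n; m≤n+m; m<m+n; m<n+m
        ; +-comm; +-assoc; +-suc; +-identityʳ; +-cancelˡ-≡; 1+n≢0; +-mono-≤; +-monoˡ-≤; +-monoˡ-<
        ; *-identityʳ; *-mono-≤; *-monoˡ-≤; *-monoʳ-≤; m^n>0; ^-monoˡ-≤; ^-monoʳ-<; ^-*-assoc; ^-distribˡ-+-*
        ; m≤n⇒m⊓n≡m; m<n⇒0<n∸m; m+[n∸m]≡n; module ≤-Reasoning )
open import Data.Nat.Solver using (module +-*-Solver)
open import Data.Nat.ListAction using (sum)
open import Data.Bool using (Bool; true; false; T; if_then_else_)
open import Data.Bool.Properties using (T?)
open import Data.Unit using (tt)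
open import Data.Fin using (Fin; zero; suc; toℕ; _≟_; _↑ˡ_; _↑ʳ_; lift)
open import Data.Fin.Properties using (pigeonhole; toℕ≤pred[n])
open import Data.List
  using (List; []; _∷_; _++_; map; concat; concatMap; replicate; tabulate; length; take; drop; filter; filterᵇ; upTo; allFin)
open import Data.List.Properties
  using ( ∷-injective; ∷-injectiveʳ; ≡-dec; ++-assoc; ++-identityʳ; ++-cancelˡ; ++-cancelʳ
        ; length-++; length-++-comm; length-++-sucʳ; length-map; length-take; length-drop; length-tabulate; take++drop≡id
        ; concat-++; concatMap-++; concatMap-map; tabulate-cong; map-tabulate; filter-notAll )
open import Data.List.Relation.Unary.Any using (Any; here; there; any?)
import Data.List.Relation.Unary.Any.Properties as Any
import Data.List.Relation.Unary.All as All
import Data.List.Relation.Unary.AllPairs as AllPairs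
open import Data.List.Relation.Unary.Unique.Propositional using (Unique)
import Data.List.Relation.Unary.Unique.Propositional.Properties as Unique
open import Data.List.Membership.Propositional using (_∈_; find; lose)
open import Data.List.Membership.Propositional.Properties
  using ( ∈-allFin; ∈-upTo⁺; ∈-length; ∈-map⁺; ∈-map⁻; map∷⁻; ∈-++⁻; ∈-∃++
        ; ∈-concatMap⁺; ∈-concatMap⁻; ∈-filter⁺ )
import Data.Vec.Functional as V
open import Data.Vec.Functional.Properties using (lookup-++ˡ; lookup-++ʳ)
open import Data.Product using (∃-syntax; _×_; _,_; proj₁; proj₂)
open import Data.Sum using (_⊎_; inj₁; inj₂; [_,_]′)
open import Data.Empty using (⊥-elim)
open import Relation.Nullary using (¬_; ¬?; yes; no; contradiction)
open import Relation.Unary using (Pred; Decidable)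
open import Relation.Binary.Definitions using (DecidableEquality)
open import Relation.Binary.PropositionalEquality
  using (_≡_; _≢_; _≗_; refl; sym; trans; cong; cong₂; subst; subst₂; module ≡-Reasoning)
open import Function using (_∘_)
open import Function.Definitions using (Injective)
open import Function.Bundles using (_⇔_; mk⇔; Equivalence)
open import Function.Construct.Composition using (_⇔-∘_)
open import Function.Construct.Symmetry using (⇔-sym)
import Relation.Binary.Reasoning.Setoid as ≈-Reasoning

open Equivalence using (to; from)
open +-*-Solver using (solve; _:+_; _:*_; _:^_; con; _:=_)

private variable
  a b p q : Level
  A X : Set a
  B Y : Set b

n<2^n : ∀ n → n < 2 ^ n
n<2^n zero    = s≤s z≤n
n<2^n (suc n) = begin-strict
  suc n         ≤⟨ n<2^n n ⟩
  2 ^ n         <⟨ m<m+n (2 ^ n) (m^n>0 2 n) ⟩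
  2 ^ n + 2 ^ n ≡⟨ cong (2 ^ n +_) (sym (+-identityʳ (2 ^ n))) ⟩
  2 ^ suc n     ∎
  where open ≤-Reasoning

-- e = 3t with t = a + b + 1:  a + e b ≤ (1 + t)³ ≤ (2 ^ t)³ = 2 ^ e.
2^-dominates-linear : ∀ a b → ∃[ e ] a + e * b ≤ 2 ^ e
2^-dominates-linear a b = t * 3 , (begin
  a + t * 3 * b                   ≤⟨ +-mono-≤ a≤t (*-monoʳ-≤ (t * 3) b≤t) ⟩
  t + t * 3 * t                   ≤⟨ m≤m+n _ _ ⟩
  t + t * 3 * t + (t * t * t + 2 * t + 1)
    ≡⟨ solve 1 (λ t → t :+ t :* con 3 :* t :+ (t :* t :* t :+ con 2 :* t :+ con 1) := (con 1 :+ t) :^ 3) refl t ⟩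
  suc t ^ 3                       ≤⟨ ^-monoˡ-≤ 3 (n<2^n t) ⟩
  (2 ^ t) ^ 3                     ≡⟨ ^-*-assoc 2 t 3 ⟩
  2 ^ (t * 3)                     ∎)
  where
  open ≤-Reasoning
  t = a + b + 1
  a≤t : a ≤ t
  a≤t = ≤-trans (m≤m+n a b) (m≤m+n (a + b) 1)
  b≤t : b ≤ t
  b≤t = ≤-trans (m≤n+m b a) (m≤m+n (a + b) 1)

-- Taking m = 2 ^ e turns the polynomial in m into a linear function of e.
2^-dominates-polynomial : ∀ c d a b → ∃[ m ] c * (a + m * b) ^ d < 2 ^ m
2^-dominates-polynomial c d a b with 2^-dominates-linear (suc (c + (a + b) * d)) d
... | e , e-large = m , (begin-strict
  c * (a + m * b) ^ d           ≤⟨ *-mono-≤ (<⇒≤ (n<2^n c)) (^-monoˡ-≤ d base≤) ⟩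
  2 ^ c * (2 ^ (a + b + e)) ^ d ≡⟨ cong (2 ^ c *_) (^-*-assoc 2 (a + b + e) d) ⟩
  2 ^ c * 2 ^ ((a + b + e) * d) ≡⟨ sym (^-distribˡ-+-* 2 c ((a + b + e) * d)) ⟩
  2 ^ (c + (a + b + e) * d)     <⟨ ^-monoʳ-< 2 (s≤s (s≤s z≤n)) exponent< ⟩
  2 ^ m                         ∎)
  where
  open ≤-Reasoning
  m = 2 ^ e
  base≤ : a + m * b ≤ 2 ^ (a + b + e)
  base≤ = begin
    a + m * b       ≤⟨ +-monoˡ-≤ (m * b) (subst (_≤ a * m) (*-identityʳ a) (*-monoʳ-≤ a (m^n>0 2 e))) ⟩
    a * m + m * b   ≡⟨ solve 3 (λ a m b → a :* m :+ m :* b := (a :+ b) :* m) refl a m b ⟩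
    (a + b) * m     ≤⟨ *-monoˡ-≤ m (<⇒≤ (n<2^n (a + b))) ⟩
    2 ^ (a + b) * m ≡⟨ sym (^-distribˡ-+-* 2 (a + b) e) ⟩
    2 ^ (a + b + e) ∎
  exponent< : c + (a + b + e) * d < m
  exponent< = begin-strict
    c + (a + b + e) * d      ≡⟨ solve 4 (λ c s e d → c :+ (s :+ e) :* d := c :+ s :* d :+ e :* d) refl c (a + b) e d ⟩
    c + (a + b) * d + e * d  <⟨ n<1+n _ ⟩
    suc (c + (a + b) * d + e * d) ≤⟨ e-large ⟩
    m                        ∎

2^-not-polynomially-bounded : ∀ c d a b → ¬ (∀ m → 2 ^ m ≤ c * (a + m * b) ^ d)
2^-not-polynomially-bounded c d a b bounded with 2^-dominates-polynomial c d a b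
... | m , smaller = <-irrefl refl (≤-<-trans (bounded m) smaller)

m+n≡m⇒n≡0 : ∀ m {n} → m + n ≡ m → n ≡ 0
m+n≡m⇒n≡0 m {n} m+n≡m = +-cancelˡ-≡ m n 0 (trans m+n≡m (sym (+-identityʳ m)))

least? : {P : ℕ → Set p} → Decidable P → ∀ n →
         (∃[ m ] (m ≤ n × P m × (∀ {j} → j < m → ¬ P j))) ⊎ (∀ {j} → j ≤ n → ¬ P j)
least? P? zero with P? zero
... | yes p0 = inj₁ (zero , z≤n , p0 , λ ())
... | no ¬p0 = inj₂ λ { z≤n → ¬p0 }
least? P? (suc n) with least? P? n
... | inj₁ (m , m≤n , pm , below) = inj₁ (m , m≤n⇒m≤1+n m≤n , pm , below)
... | inj₂ none with P? (suc n)
...   | yes p = inj₁ (suc n , ≤-refl , p , none ∘ m<1+n⇒m≤n)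
...   | no ¬p = inj₂ λ j≤1+n → [ none ∘ m<1+n⇒m≤n , (λ { refl → ¬p }) ]′ (m≤n⇒m<n∨m≡n j≤1+n)

tabulate-+ : ∀ m {n} (f : Fin (m + n) → X) →
             tabulate f ≡ tabulate (f ∘ (_↑ˡ n)) ++ tabulate (f ∘ (m ↑ʳ_))
tabulate-+ zero    f = refl
tabulate-+ (suc m) f = cong (f zero ∷_) (tabulate-+ m (f ∘ suc))

++-prefix : (xs ys zs ws : List A) → xs ++ ys ≡ zs ++ ws → length xs ≤ length zs →
            ∃[ t ] zs ≡ xs ++ t
++-prefix []       ys zs       ws eq _ = zs , refl
++-prefix (x ∷ xs) ys (z ∷ zs) ws eq (s≤s |xs|≤|zs|) with ∷-injective eq
... | refl , eq′ with ++-prefix xs ys zs ws eq′ |xs|≤|zs|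
...   | t , refl = t , refl

++-injective : ∀ (xs ys xs′ ys′ : List A) → length xs ≡ length xs′ → xs ++ ys ≡ xs′ ++ ys′ → xs ≡ xs′ × ys ≡ ys′
++-injective []       ys []        ys′ _     eq = refl , eq
++-injective (x ∷ xs) ys (x′ ∷ xs′) ys′ |xs|≡ eq with ∷-injective eq
... | refl , eq′ with ++-injective xs ys xs′ ys′ (cong pred |xs|≡) eq′
...   | refl , refl = refl , refl

module _ (_≟_ : DecidableEquality A) where

  removeAll : A → List A → List A
  removeAll x = filter (λ y → ¬? (y ≟ x))

  ∈-removeAll⁺ : ∀ {x y xs} → y ∈ xs → y ≢ x → y ∈ removeAll x xs
  ∈-removeAll⁺ = ∈-filter⁺ (λ y → ¬? (y ≟ _))

  removeAll-shorter : ∀ {x xs} → x ∈ xs → length (removeAll x xs) < length xs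
  removeAll-shorter {x} {xs} x∈xs = filter-notAll (λ y → ¬? (y ≟ x)) xs (lose x∈xs λ x≢x → x≢x refl)

∈⇒≤sum : ∀ {n ns} → n ∈ ns → n ≤ sum ns
∈⇒≤sum {ns = n ∷ ns}  (here refl) = m≤m+n n (sum ns)
∈⇒≤sum {ns = m ∷ ns}  (there n∈) = ≤-trans (∈⇒≤sum n∈) (m≤n+m (sum ns) m)

Unique⇒length≤ : ∀ {xs ys : List A} → Unique xs → (∀ {x} → x ∈ xs → x ∈ ys) → length xs ≤ length ys
Unique⇒length≤ {xs = []}     _                 _    = z≤n
Unique⇒length≤ {xs = x ∷ xs} (x∉xs AllPairs.∷ unique) xs⊆ys with ∈-∃++ (xs⊆ys (here refl))
... | ys₁ , ys₂ , refl = subst (suc (length xs) ≤_) (sym (length-++-sucʳ ys₁ x ys₂))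
                           (s≤s (Unique⇒length≤ unique (λ x′∈xs → remove ys₁ (xs⊆ys (there x′∈xs)) (≢x x′∈xs))))
  where
  ≢x : ∀ {x′} → x′ ∈ xs → x′ ≢ x
  ≢x x′∈xs x′≡x = All.lookup x∉xs x′∈xs (sym x′≡x)
  remove : ∀ ys₁ {x′} → x′ ∈ ys₁ ++ x ∷ ys₂ → x′ ≢ x → x′ ∈ ys₁ ++ ys₂
  remove []        (here x′≡x) x′≢x = contradiction x′≡x x′≢x
  remove []        (there x′∈) _    = x′∈
  remove (_ ∷ ys₁) (here x′≡y) _    = here x′≡y
  remove (_ ∷ ys₁) (there x′∈) x′≢x = there (remove ys₁ x′∈ x′≢x)

length-concatMap : ∀ {f : A → List B} ℓ → (∀ x → length (f x) ≡ ℓ) → ∀ xs → length (concatMap f xs) ≡ length xs * ℓ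
length-concatMap ℓ |f|≡ℓ []       = refl
length-concatMap {f = f} ℓ |f|≡ℓ (x ∷ xs) =
  trans (length-++ (f x)) (cong₂ _+_ (|f|≡ℓ x) (length-concatMap ℓ |f|≡ℓ xs))

concatMap-injective : ∀ {f : A → List B} ℓ → (∀ x → length (f x) ≡ suc ℓ) → Injective _≡_ _≡_ f →
                      Injective _≡_ _≡_ (concatMap f)
concatMap-injective {f = f} ℓ |f|≡ f-injective {[]}     {[]}     _  = refl
concatMap-injective {f = f} ℓ |f|≡ f-injective {[]}     {y ∷ ys} eq =
  contradiction (trans (cong length eq) (trans (length-++ (f y)) (cong (_+ _) (|f|≡ y)))) λ ()
concatMap-injective {f = f} ℓ |f|≡ f-injective {x ∷ xs} {[]}     eq =
  contradiction (trans (cong length (sym eq)) (trans (length-++ (f x)) (cong (_+ _) (|f|≡ x)))) λ ()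
concatMap-injective {f = f} ℓ |f|≡ f-injective {x ∷ xs} {y ∷ ys} eq
  with ++-injective (f x) _ (f y) _ (trans (|f|≡ x) (sym (|f|≡ y))) eq
... | fx≡fy , rest = cong₂ _∷_ (f-injective fx≡fy) (concatMap-injective ℓ |f|≡ f-injective rest)

noncommuting-nonempty : ∀ (x y : List A) → x ++ y ≢ y ++ x → ∃[ ℓ ] length (x ++ y) ≡ suc ℓ
noncommuting-nonempty []      []      xy≢yx = contradiction refl xy≢yx
noncommuting-nonempty []      (b ∷ y) _     = length y , refl
noncommuting-nonempty (a ∷ x) y       _     = length (x ++ y) , refl

bitStrings : ℕ → List (List Bool)
bitStrings zero    = [] ∷ []
bitStrings (suc m) = map (true ∷_) (bitStrings m) ++ map (false ∷_) (bitStrings m)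

length-bitStrings : ∀ m → length (bitStrings m) ≡ 2 ^ m
length-bitStrings zero    = refl
length-bitStrings (suc m) = begin
  length (map (true ∷_) (bitStrings m) ++ map (false ∷_) (bitStrings m))
    ≡⟨ length-++ (map (true ∷_) (bitStrings m)) ⟩
  length (map (true ∷_) (bitStrings m)) + length (map (false ∷_) (bitStrings m))
    ≡⟨ cong₂ _+_ (length-map _ (bitStrings m)) (length-map _ (bitStrings m)) ⟩
  length (bitStrings m) + length (bitStrings m)
    ≡⟨ cong (λ n → n + n) (length-bitStrings m) ⟩
  2 ^ m + 2 ^ m
    ≡⟨ cong (2 ^ m +_) (+-identityʳ (2 ^ m)) ⟨
  2 ^ suc m ∎
  where open ≡-Reasoning

∈-bitStrings⇒length : ∀ m {bs} → bs ∈ bitStrings m → length bs ≡ m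
∈-bitStrings⇒length zero    (here refl) = refl
∈-bitStrings⇒length (suc m) bs∈ with ∈-++⁻ (map (true ∷_) (bitStrings m)) bs∈
... | inj₁ bs∈₁ with _ , bs′∈ , refl ← ∈-map⁻ (true ∷_) bs∈₁  = cong suc (∈-bitStrings⇒length m bs′∈)
... | inj₂ bs∈₂ with _ , bs′∈ , refl ← ∈-map⁻ (false ∷_) bs∈₂ = cong suc (∈-bitStrings⇒length m bs′∈)

bitStrings-unique : ∀ m → Unique (bitStrings m)
bitStrings-unique zero    = All.[] AllPairs.∷ AllPairs.[]
bitStrings-unique (suc m) =
  Unique.++⁺ (Unique.map⁺ ∷-injectiveʳ (bitStrings-unique m)) (Unique.map⁺ ∷-injectiveʳ (bitStrings-unique m))
             disjoint
  where
  disjoint : ∀ {bs} → ¬ (bs ∈ map (true ∷_) (bitStrings m) × bs ∈ map (false ∷_) (bitStrings m))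
  disjoint (bs∈₁ , bs∈₂) with ∈-map⁻ (true ∷_) bs∈₁ | ∈-map⁻ (false ∷_) bs∈₂
  ... | _ , _ , refl | _ , _ , ()

renameTerm : ∀ {n m} → (Fin n → Fin m) → Term n → Term m
renameTerm r (var i) = var (r i)
renameTerm r (t ⊕ u) = renameTerm r t ⊕ renameTerm r u

rename : ∀ {n m} → (Fin n → Fin m) → Formula n → Formula m
rename r (t ≐ u)  = renameTerm r t ≐ renameTerm r u
rename r (~ φ)    = ~ rename r φ
rename r (φ ∧' ψ) = rename r φ ∧' rename r ψ
rename r (φ ∨' ψ) = rename r φ ∨' rename r ψ
rename r (∀' φ)   = ∀' (rename (lift 1 r) φ)
rename r (∃' φ)   = ∃' (rename (lift 1 r) φ)

module _ {n m} (r : Fin n → Fin m) {ρ : Fin m → ℕ} {σ : Fin n → ℕ} (ρ∘r≗σ : ∀ i → ρ (r i) ≡ σ i) where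

  evalTerm-rename : ∀ t → evalTerm ρ (renameTerm r t) ≡ evalTerm σ t
  evalTerm-rename (var i) = ρ∘r≗σ i
  evalTerm-rename (t ⊕ u) = cong₂ _+_ (evalTerm-rename t) (evalTerm-rename u)

  extend-lift : ∀ x i → extend x ρ (lift 1 r i) ≡ extend x σ i
  extend-lift x zero    = refl
  extend-lift x (suc i) = ρ∘r≗σ i

Sat-rename : ∀ {n m} (r : Fin n → Fin m) {ρ σ} → (∀ i → ρ (r i) ≡ σ i) →
             (φ : Formula n) → Sat (rename r φ) ρ ⇔ Sat φ σ
Sat-rename r eq (t ≐ u) = mk⇔
  (subst₂ _≡_ (evalTerm-rename r eq t) (evalTerm-rename r eq u))
  (subst₂ _≡_ (sym (evalTerm-rename r eq t)) (sym (evalTerm-rename r eq u)))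
Sat-rename r eq (~ φ) = mk⇔ (λ ¬s s → ¬s (from (Sat-rename r eq φ) s))
                            (λ ¬s s → ¬s (to (Sat-rename r eq φ) s))
Sat-rename r eq (φ ∧' ψ) = mk⇔
  (λ (s , t) → to (Sat-rename r eq φ) s , to (Sat-rename r eq ψ) t)
  (λ (s , t) → from (Sat-rename r eq φ) s , from (Sat-rename r eq ψ) t)
Sat-rename r eq (φ ∨' ψ) = mk⇔
  (λ { (inj₁ s) → inj₁ (to (Sat-rename r eq φ) s) ; (inj₂ t) → inj₂ (to (Sat-rename r eq ψ) t) })
  (λ { (inj₁ s) → inj₁ (from (Sat-rename r eq φ) s) ; (inj₂ t) → inj₂ (from (Sat-rename r eq ψ) t) })
Sat-rename r eq (∀' φ) = mk⇔
  (λ s x → to   (Sat-rename (lift 1 r) (extend-lift r eq x) φ) (s x))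
  (λ s x → from (Sat-rename (lift 1 r) (extend-lift r eq x) φ) (s x))
Sat-rename r eq (∃' φ) = mk⇔
  (λ (x , s) → x , to   (Sat-rename (lift 1 r) (extend-lift r eq x) φ) s)
  (λ (x , s) → x , from (Sat-rename (lift 1 r) (extend-lift r eq x) φ) s)

⊤ᶠ : ∀ {n} → Formula n
⊤ᶠ = ∀' (var zero ≐ var zero)

⊥ᶠ : ∀ {n} → Formula n
⊥ᶠ = ~ ⊤ᶠ

-- The language of (ℕ, +) has no constant 0; x = 0 is expressed as x + x = x.
IsZeroᶠ : ∀ {n} → Fin n → Formula n
IsZeroᶠ i = (var i ⊕ var i) ≐ var i

Sat-IsZero : ∀ {n} (i : Fin n) ρ → Sat (IsZeroᶠ i) ρ ⇔ ρ i ≡ 0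
Sat-IsZero i ρ = mk⇔ (m+n≡m⇒n≡0 (ρ i)) (λ ρi≡0 → subst (λ v → v + v ≡ v) (sym ρi≡0) refl)

AllZeroᶠ : ∀ {n m} → (Fin n → Fin m) → Formula m
AllZeroᶠ {zero}  r = ⊤ᶠ
AllZeroᶠ {suc n} r = IsZeroᶠ (r zero) ∧' AllZeroᶠ (r ∘ suc)

Sat-AllZero : ∀ {n m} (r : Fin n → Fin m) ρ → Sat (AllZeroᶠ r) ρ ⇔ (∀ i → ρ (r i) ≡ 0)
Sat-AllZero {zero}  r ρ = mk⇔ (λ _ ()) (λ _ _ → refl)
Sat-AllZero {suc n} r ρ = mk⇔
  (λ { (z , zs) zero → to (Sat-IsZero (r zero) ρ) z ; (z , zs) (suc i) → to (Sat-AllZero (r ∘ suc) ρ) zs i })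
  (λ zs → from (Sat-IsZero (r zero) ρ) (zs zero) , from (Sat-AllZero (r ∘ suc) ρ) (zs ∘ suc))

-- x = 1 is expressed as: x ≠ 0, and x is not a sum of two nonzero numbers.
IsOneᶠ : Formula 1
IsOneᶠ = (~ IsZeroᶠ zero) ∧' ∀' (∀' ((~ (var (suc (suc zero)) ≐ (var (suc zero) ⊕ var zero)))
                                   ∨' (IsZeroᶠ (suc zero) ∨' IsZeroᶠ zero)))

Sat-IsOne : ∀ ρ → Sat IsOneᶠ ρ ⇔ ρ zero ≡ 1
Sat-IsOne ρ = mk⇔ (IsOne⇒≡1 (ρ zero)) (λ ρ0≡1 → subst IsOne (sym ρ0≡1) IsOne-1)
  where
  IsOne : ℕ → Set
  IsOne n = ¬ (n + n ≡ n) × (∀ x y → ¬ (n ≡ x + y) ⊎ ((x + x ≡ x) ⊎ (y + y ≡ y)))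
  IsOne⇒≡1 : ∀ n → IsOne n → n ≡ 1
  IsOne⇒≡1 zero          (≢0 , _) = contradiction refl ≢0
  IsOne⇒≡1 (suc zero)    _        = refl
  IsOne⇒≡1 (suc (suc j)) (_ , indecomposable) with indecomposable 1 (suc j)
  ... | inj₁ ≢1+[1+j]    = contradiction refl ≢1+[1+j]
  ... | inj₂ (inj₂ 1+j≡0) = contradiction (m+n≡m⇒n≡0 (suc j) 1+j≡0) 1+n≢0
  IsOne-1 : IsOne 1
  IsOne-1 = (λ ()) , indecomposable
    where
    1≢2+ : ∀ x y → ¬ (1 ≡ suc x + suc y)
    1≢2+ zero    y ()
    1≢2+ (suc x) y ()
    indecomposable : ∀ x y → ¬ (1 ≡ x + y) ⊎ ((x + x ≡ x) ⊎ (y + y ≡ y))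
    indecomposable zero    y       = inj₂ (inj₁ refl)
    indecomposable (suc x) zero    = inj₂ (inj₂ refl)
    indecomposable (suc x) (suc y) = inj₁ (1≢2+ x y)

-- Bounded languages σ₁* ⋯ σₙ* cut out by formulas

power : List X → ℕ → List X
power σ m = concat (replicate m σ)

tuplePower : ∀ {n} → (Fin n → List X) → (Fin n → ℕ) → List X
tuplePower s k = concat (tabulate (λ i → power (s i) (k i)))

tuplePower-congˡ : ∀ {n} {s s′ : Fin n → List X} → s ≗ s′ → (k : Fin n → ℕ) → tuplePower s k ≡ tuplePower s′ k
tuplePower-congˡ s≗s′ k = cong concat (tabulate-cong (λ i → cong (λ σ → power σ (k i)) (s≗s′ i)))

tuplePower-congʳ : ∀ {n} (s : Fin n → List X) {k k′ : Fin n → ℕ} → k ≗ k′ → tuplePower s k ≡ tuplePower s k′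
tuplePower-congʳ s k≗k′ = cong concat (tabulate-cong (λ i → cong (power (s i)) (k≗k′ i)))

tuplePower-+ : ∀ m {n} (s : Fin (m + n) → List X) (k : Fin (m + n) → ℕ) →
               tuplePower s k ≡ tuplePower (s ∘ (_↑ˡ n)) (k ∘ (_↑ˡ n)) ++ tuplePower (s ∘ (m ↑ʳ_)) (k ∘ (m ↑ʳ_))
tuplePower-+ m {n} s k =
  trans (cong concat (tabulate-+ m f)) (sym (concat-++ (tabulate (f ∘ (_↑ˡ n))) (tabulate (f ∘ (m ↑ʳ_)))))
  where f = λ i → power (s i) (k i)

tuplePower-zeros : ∀ {n} (s : Fin n → List X) {k : Fin n → ℕ} → (∀ i → k i ≡ 0) → tuplePower s k ≡ []
tuplePower-zeros {n = zero}  s k≡0 = refl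
tuplePower-zeros {n = suc n} s k≡0 rewrite k≡0 zero = tuplePower-zeros (s ∘ suc) (k≡0 ∘ suc)

module _ {m n} (s₁ : Fin m → List X) (s₂ : Fin n → List X) where

  tuplePower-++ : (k : Fin (m + n) → ℕ) →
                  tuplePower (s₁ V.++ s₂) k ≡ tuplePower s₁ (k ∘ (_↑ˡ n)) ++ tuplePower s₂ (k ∘ (m ↑ʳ_))
  tuplePower-++ k = trans (tuplePower-+ m (s₁ V.++ s₂) k)
    (cong₂ _++_ (tuplePower-congˡ (lookup-++ˡ s₁ s₂) (k ∘ (_↑ˡ n)))
                (tuplePower-congˡ (lookup-++ʳ s₁ s₂) (k ∘ (m ↑ʳ_))))

  tuplePower-++-++ : (k₁ : Fin m → ℕ) (k₂ : Fin n → ℕ) →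
                     tuplePower (s₁ V.++ s₂) (k₁ V.++ k₂) ≡ tuplePower s₁ k₁ ++ tuplePower s₂ k₂
  tuplePower-++-++ k₁ k₂ = trans (tuplePower-++ (k₁ V.++ k₂))
    (cong₂ _++_ (tuplePower-congʳ s₁ (lookup-++ˡ k₁ k₂)) (tuplePower-congʳ s₂ (lookup-++ʳ k₁ k₂)))

module _ (g : X → List Y) where

  concatMap-power : ∀ σ m → concatMap g (power σ m) ≡ power (concatMap g σ) m
  concatMap-power σ zero    = refl
  concatMap-power σ (suc m) = trans (concatMap-++ g σ (power σ m)) (cong (concatMap g σ ++_) (concatMap-power σ m))

  concatMap-concat : ∀ xss → concatMap g (concat xss) ≡ concat (map (concatMap g) xss)
  concatMap-concat []         = refl
  concatMap-concat (xs ∷ xss) =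
    trans (concatMap-++ g xs (concat xss)) (cong (concatMap g xs ++_) (concatMap-concat xss))

  concatMap-tuplePower : ∀ {n} (s : Fin n → List X) k → concatMap g (tuplePower s k) ≡ tuplePower (concatMap g ∘ s) k
  concatMap-tuplePower s k = trans (concatMap-concat (tabulate (λ i → power (s i) (k i))))
    (cong concat (trans (map-tabulate (λ i → power (s i) (k i)) (concatMap g))
                        (tabulate-cong (λ i → concatMap-power (s i) (k i)))))

record BoundedLanguage (X : Set a) : Set a where
  constructor bounded
  field
    arity     : ℕ
    generator : Fin arity → List X
    condition : Formula arity

open BoundedLanguage

SomeWord : BoundedLanguage X → (List X → Set p) → Set p
SomeWord B P = ∃[ k ] (Sat (condition B) k × P (tuplePower (generator B) k))

SomeWord-mono : (B : BoundedLanguage X) {P : List X → Set p} {Q : List X → Set q} →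
                (∀ σ → P σ → Q σ) → SomeWord B P → SomeWord B Q
SomeWord-mono B P⇒Q (k , sat , pk) = k , sat , P⇒Q _ pk

SomeWord-witness : (B : BoundedLanguage X) {P : List X → Set p} →
                   SomeWord B P ⇔ (∃[ σ ] (SomeWord B (_≡ σ) × P σ))
SomeWord-witness B {P} = mk⇔
  (λ (k , sat , pk) → _ , (k , sat , refl) , pk)
  (λ (σ , (k , sat , eq) , pσ) → k , sat , subst P (sym eq) pσ)

∅ᴮ : BoundedLanguage X
∅ᴮ = bounded 0 (λ ()) ⊥ᶠ

SomeWord-∅ : {P : List X → Set p} → ¬ SomeWord ∅ᴮ P
SomeWord-∅ (_ , ⊥-sat , _) = ⊥-sat (λ _ → refl)

-- Each side of the union keeps the variables of the other one at 0.
_∪ᴮ_ : BoundedLanguage X → BoundedLanguage X → BoundedLanguage X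
bounded m s₁ φ₁ ∪ᴮ bounded n s₂ φ₂ = bounded (m + n) (s₁ V.++ s₂)
  ((rename (_↑ˡ n) φ₁ ∧' AllZeroᶠ (m ↑ʳ_)) ∨' (rename (m ↑ʳ_) φ₂ ∧' AllZeroᶠ (_↑ˡ n)))

SomeWord-∪ : (B₁ B₂ : BoundedLanguage X) {P : List X → Set p} →
             SomeWord (B₁ ∪ᴮ B₂) P ⇔ (SomeWord B₁ P ⊎ SomeWord B₂ P)
SomeWord-∪ B₁@(bounded m s₁ φ₁) B₂@(bounded n s₂ φ₂) {P} = mk⇔ split join
  where
  zeros : ∀ {r} → Fin r → ℕ
  zeros _ = 0
  word-left : ∀ k → (∀ i → k (m ↑ʳ i) ≡ 0) → tuplePower (s₁ V.++ s₂) k ≡ tuplePower s₁ (k ∘ (_↑ˡ n))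
  word-left k right≡0 =
    trans (tuplePower-++ s₁ s₂ k) (trans (cong (_ ++_) (tuplePower-zeros s₂ right≡0)) (++-identityʳ _))
  word-right : ∀ k → (∀ i → k (i ↑ˡ n) ≡ 0) → tuplePower (s₁ V.++ s₂) k ≡ tuplePower s₂ (k ∘ (m ↑ʳ_))
  word-right k left≡0 = trans (tuplePower-++ s₁ s₂ k) (cong (_++ _) (tuplePower-zeros s₁ left≡0))
  split : SomeWord (B₁ ∪ᴮ B₂) P → SomeWord B₁ P ⊎ SomeWord B₂ P
  split (k , inj₁ (sat₁ , right≡0) , pk) = inj₁ (k ∘ (_↑ˡ n) , to (Sat-rename (_↑ˡ n) (λ _ → refl) φ₁) sat₁ ,
    subst P (word-left k (to (Sat-AllZero (m ↑ʳ_) k) right≡0)) pk)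
  split (k , inj₂ (sat₂ , left≡0) , pk) = inj₂ (k ∘ (m ↑ʳ_) , to (Sat-rename (m ↑ʳ_) (λ _ → refl) φ₂) sat₂ ,
    subst P (word-right k (to (Sat-AllZero (_↑ˡ n) k) left≡0)) pk)
  join : SomeWord B₁ P ⊎ SomeWord B₂ P → SomeWord (B₁ ∪ᴮ B₂) P
  join (inj₁ (k₁ , sat₁ , pk)) = k ,
    inj₁ (from (Sat-rename (_↑ˡ n) (lookup-++ˡ k₁ zeros) φ₁) sat₁ ,
          from (Sat-AllZero (m ↑ʳ_) k) (lookup-++ʳ k₁ zeros)) ,
    subst P (sym (trans (word-left k (lookup-++ʳ k₁ zeros)) (tuplePower-congʳ s₁ (lookup-++ˡ k₁ zeros)))) pk
    where k = k₁ V.++ zeros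
  join (inj₂ (k₂ , sat₂ , pk)) = k ,
    inj₂ (from (Sat-rename (m ↑ʳ_) (lookup-++ʳ (zeros {m}) k₂) φ₂) sat₂ ,
          from (Sat-AllZero (_↑ˡ n) k) (lookup-++ˡ (zeros {m}) k₂)) ,
    subst P (sym (trans (word-right k (lookup-++ˡ (zeros {m}) k₂)) (tuplePower-congʳ s₂ (lookup-++ʳ (zeros {m}) k₂)))) pk
    where k = zeros {m} V.++ k₂

_·ᴮ_ : BoundedLanguage X → BoundedLanguage X → BoundedLanguage X
bounded m s₁ φ₁ ·ᴮ bounded n s₂ φ₂ = bounded (m + n) (s₁ V.++ s₂) (rename (_↑ˡ n) φ₁ ∧' rename (m ↑ʳ_) φ₂)

SomeWord-· : (B₁ B₂ : BoundedLanguage X) {P : List X → Set p} →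
             SomeWord (B₁ ·ᴮ B₂) P ⇔ SomeWord B₁ (λ σ → SomeWord B₂ (λ τ → P (σ ++ τ)))
SomeWord-· (bounded m s₁ φ₁) (bounded n s₂ φ₂) {P} = mk⇔
  (λ (k , (sat₁ , sat₂) , pk) →
     k ∘ (_↑ˡ n) , to (Sat-rename (_↑ˡ n) (λ _ → refl) φ₁) sat₁ ,
     k ∘ (m ↑ʳ_) , to (Sat-rename (m ↑ʳ_) (λ _ → refl) φ₂) sat₂ , subst P (tuplePower-++ s₁ s₂ k) pk)
  (λ (k₁ , sat₁ , k₂ , sat₂ , pk) →
     k₁ V.++ k₂ ,
     (from (Sat-rename (_↑ˡ n) (lookup-++ˡ k₁ k₂) φ₁) sat₁ , from (Sat-rename (m ↑ʳ_) (lookup-++ʳ k₁ k₂) φ₂) sat₂) ,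
     subst P (sym (tuplePower-++-++ s₁ s₂ k₁ k₂)) pk)

starᴮ : List X → BoundedLanguage X
starᴮ σ = bounded 1 (λ _ → σ) ⊤ᶠ

SomeWord-star : ∀ σ {P : List X → Set p} → SomeWord (starᴮ σ) P ⇔ (∃[ e ] P (power σ e))
SomeWord-star σ {P} = mk⇔
  (λ (k , _ , pk) → k zero , subst P (++-identityʳ _) pk)
  (λ (e , pe) → (λ _ → e) , (λ _ → refl) , subst P (sym (++-identityʳ _)) pe)

wordᴮ : List X → BoundedLanguage X
wordᴮ σ = bounded 1 (λ _ → σ) IsOneᶠ

SomeWord-word : ∀ σ {P : List X → Set p} → SomeWord (wordᴮ σ) P ⇔ P σ
SomeWord-word σ {P} = mk⇔
  (λ (k , sat , pk) → subst P (trans (cong (λ e → power σ e ++ []) (to (Sat-IsOne k) sat)) σ¹≡σ) pk)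
  (λ pσ → (λ _ → 1) , from (Sat-IsOne (λ _ → 1)) refl , subst P (sym σ¹≡σ) pσ)
  where
  σ¹≡σ : power σ 1 ++ [] ≡ σ
  σ¹≡σ = trans (++-identityʳ _) (++-identityʳ σ)

⋃ᴮ : List (BoundedLanguage X) → BoundedLanguage X
⋃ᴮ []       = ∅ᴮ
⋃ᴮ (B ∷ Bs) = B ∪ᴮ ⋃ᴮ Bs

SomeWord-⋃ : (Bs : List (BoundedLanguage X)) {P : List X → Set p} →
             SomeWord (⋃ᴮ Bs) P ⇔ Any (λ B → SomeWord B P) Bs
SomeWord-⋃ []       {P} = mk⇔ (⊥-elim ∘ SomeWord-∅ {P = P}) (λ ())
SomeWord-⋃ (B ∷ Bs) {P} = mk⇔
  (λ w → [ here , there ∘ to (SomeWord-⋃ Bs {P}) ]′ (to (SomeWord-∪ B (⋃ᴮ Bs) {P}) w))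
  (λ { (here w) → from (SomeWord-∪ B (⋃ᴮ Bs) {P}) (inj₁ w)
     ; (there w) → from (SomeWord-∪ B (⋃ᴮ Bs) {P}) (inj₂ (from (SomeWord-⋃ Bs {P}) w)) })

imageᴮ : (X → List Y) → BoundedLanguage X → BoundedLanguage Y
imageᴮ g (bounded n s φ) = bounded n (concatMap g ∘ s) φ

SomeWord-image : (g : X → List Y) (B : BoundedLanguage X) {P : List Y → Set p} →
                 SomeWord (imageᴮ g B) P ⇔ SomeWord B (P ∘ concatMap g)
SomeWord-image g (bounded n s φ) {P} = mk⇔
  (λ (k , sat , pk) → k , sat , subst P (sym (concatMap-tuplePower g s k)) pk)
  (λ (k , sat , pk) → k , sat , subst P (concatMap-tuplePower g s k) pk)

-- Automata

∈-words : ∀ {k} (w : List (Fin k)) → w ∈ words k (length w)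
∈-words []      = here refl
∈-words (a ∷ w) = ∈-concatMap⁺ _ (lose (∈-allFin a) (∈-map⁺ (a ∷_) (∈-words w)))

words-length : ∀ {k} n {w : List (Fin k)} → w ∈ words k n → length w ≡ n
words-length zero    (here refl) = refl
words-length (suc n) w∈ with find (∈-concatMap⁻ _ {xs = allFin _} w∈)
... | i , _ , w∈i∷ with map∷⁻ {y = i} w∈i∷
...   | _ , ys∈ , refl = cong suc (words-length n ys∈)

module Automaton {k : ℕ} (M : DFA k) where

  open DFA M

  State = Fin nStates
  Word  = List (Fin k)

  run-++ : ∀ q (x y : Word) → run M q (x ++ y) ≡ run M (run M q x) y
  run-++ q []      y = refl
  run-++ q (a ∷ x) y = run-++ (δ q a) x y

  Loop : State → Word → Set
  Loop q y = run M q y ≡ q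

  run-loop-++ : ∀ {q} v w → Loop q v → run M q (v ++ w) ≡ run M q w
  run-loop-++ {q} v w loop-v = trans (run-++ q v w) (cong (λ q′ → run M q′ w) loop-v)

  loop-++ : ∀ {q} x y → Loop q x → Loop q y → Loop q (x ++ y)
  loop-++ x y loop-x loop-y = trans (run-loop-++ x y loop-x) loop-y

  loop-suffix : ∀ {q} x y → Loop q x → Loop q (x ++ y) → Loop q y
  loop-suffix x y loop-x loop-xy = trans (sym (run-loop-++ x y loop-x)) loop-xy

  loop-power : ∀ {q} y → Loop q y → ∀ e → Loop q (power y e)
  loop-power y loop zero    = refl
  loop-power y loop (suc e) = loop-++ y (power y e) loop (loop-power y loop e)

  -- By pigeonhole two prefixes of y of lengths m < n ≤ nStates reach the same state, so cutting out
  -- the segment between them leaves a loop.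
  shorter-loop : ∀ {q y} → Loop q y → nStates < length y →
                 ∃[ y′ ] (Loop q y′ × 0 < length y′ × length y′ < length y)
  shorter-loop {q} {y} loop N<L with pigeonhole ≤-refl (λ i → run M q (take (toℕ i) y))
  ... | i , j , i<j , same-state = take m y ++ drop n y , cut-loop , 0<length , length<
    where
    m = toℕ i
    n = toℕ j
    L = length y
    n<L : n < L
    n<L = ≤-<-trans (toℕ≤pred[n] j) N<L
    length-cut : length (take m y ++ drop n y) ≡ m + (L ∸ n)
    length-cut = trans (length-++ (take m y))
      (cong₂ _+_ (trans (length-take m y) (m≤n⇒m⊓n≡m (<⇒≤ (<-trans i<j n<L)))) (length-drop n y))
    cut-loop : Loop q (take m y ++ drop n y)
    cut-loop = begin
      run M q (take m y ++ drop n y)          ≡⟨ run-++ q (take m y) (drop n y) ⟩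
      run M (run M q (take m y)) (drop n y)   ≡⟨ cong (λ q′ → run M q′ (drop n y)) same-state ⟩
      run M (run M q (take n y)) (drop n y)   ≡⟨ run-++ q (take n y) (drop n y) ⟨
      run M q (take n y ++ drop n y)          ≡⟨ cong (run M q) (take++drop≡id n y) ⟩
      run M q y                               ≡⟨ loop ⟩
      q                                       ∎
      where open ≡-Reasoning
    0<length : 0 < length (take m y ++ drop n y)
    0<length = subst (0 <_) (sym length-cut) (≤-trans (m<n⇒0<n∸m n<L) (m≤n+m (L ∸ n) m))
    length< : length (take m y ++ drop n y) < L
    length< = subst₂ _<_ (sym length-cut) (m+[n∸m]≡n (<⇒≤ n<L)) (+-monoˡ-< (L ∸ n) i<j)

  bounded-loop : ∀ {q} y → Loop q y → 0 < length y →
                 ∃[ y′ ] (Loop q y′ × 0 < length y′ × length y′ ≤ nStates)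
  bounded-loop y = go (length y) y ≤-refl
    where
    go : ∀ n {q} y → length y ≤ n → Loop q y → 0 < length y →
         ∃[ y′ ] (Loop q y′ × 0 < length y′ × length y′ ≤ nStates)
    go n y L≤n loop nonempty with length y ≤? nStates
    ... | yes L≤N = y , loop , nonempty , L≤N
    go zero    y L≤0   loop nonempty | no _ = contradiction (≤-trans nonempty L≤0) (λ ())
    go (suc n) y L≤1+n loop nonempty | no L≰N with shorter-loop {y = y} loop (≰⇒> L≰N)
    ... | y′ , loop′ , nonempty′ , shorter = go n y′ (m<1+n⇒m≤n (<-≤-trans shorter L≤1+n)) loop′ nonempty′

  IsShortestLoop : State → Word → Set
  IsShortestLoop q z = Loop q z × (∀ y → Loop q y → 0 < length y → 0 < length z × length z ≤ length y)

  LoopOfLength : State → ℕ → Set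
  LoopOfLength q n = Any (Loop q) (words k n)

  nonempty-loop-length : ∀ q y → Loop q y → 0 < length y → ∃[ j ] (LoopOfLength q (suc j) × suc j ≡ length y)
  nonempty-loop-length q (a ∷ y) loop _ = length y , lose (∈-words (a ∷ y)) loop , refl

  minimal-loop-shortest : ∀ q m → LoopOfLength q (suc m) → (∀ {j} → j < m → ¬ LoopOfLength q (suc j)) →
                          ∃[ z ] IsShortestLoop q z
  minimal-loop-shortest q m has-loop none-shorter with find has-loop
  ... | z , z∈ , loop = z , loop , λ y loop-y nonempty →
    let j , loop-j , 1+j≡|y| = nonempty-loop-length q y loop-y nonempty in
    subst (0 <_) (sym |z|≡1+m) (s≤s z≤n) ,
    subst₂ _≤_ (sym |z|≡1+m) 1+j≡|y| (s≤s (≮⇒≥ (λ j<m → none-shorter j<m loop-j)))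
    where
    |z|≡1+m : length z ≡ suc m
    |z|≡1+m = words-length (suc m) z∈

  -- Having no nonempty loop of length ≤ nStates, q has none at all, and [] serves as its shortest loop.
  no-bounded-loop-shortest : ∀ q → (∀ {j} → j ≤ nStates → ¬ LoopOfLength q (suc j)) → IsShortestLoop q []
  no-bounded-loop-shortest q none = refl , λ y loop-y nonempty →
    let y′ , loop′ , nonempty′ , |y′|≤N = bounded-loop y loop-y nonempty
        j , loop-j , 1+j≡|y′| = nonempty-loop-length q y′ loop′ nonempty′
    in contradiction loop-j (none (≤-trans (n≤1+n j) (subst (_≤ nStates) (sym 1+j≡|y′|) |y′|≤N)))

  shortest-loop : ∀ q → ∃[ z ] IsShortestLoop q z
  shortest-loop q with least? (λ j → any? (λ y → run M q y ≟ q) (words k (suc j))) nStates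
  ... | inj₁ (m , _ , has-loop , none-shorter) = minimal-loop-shortest q m has-loop none-shorter
  ... | inj₂ none                              = [] , no-bounded-loop-shortest q none

  shortestLoop : State → Word
  shortestLoop q = proj₁ (shortest-loop q)

  shortestLoop-loop : ∀ q → Loop q (shortestLoop q)
  shortestLoop-loop q = proj₁ (proj₂ (shortest-loop q))

  shortestLoop-shortest : ∀ q y → Loop q y → 0 < length y →
                          0 < length (shortestLoop q) × length (shortestLoop q) ≤ length y
  shortestLoop-shortest q = proj₂ (proj₂ (shortest-loop q))

  Reachable : State → Set
  Reachable q = ∃[ p ] run M start p ≡ q

  reachable-run : ∀ {q} → Reachable q → ∀ x → Reachable (run M q x)
  reachable-run (p , refl) x = p ++ x , run-++ start p x

  AcceptedFrom : State → Word → Set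
  AcceptedFrom q w = final (run M q w) ≡ true

  accepted-loop-++ : ∀ {q} v w → Loop q v → AcceptedFrom q (v ++ w) ⇔ AcceptedFrom q w
  accepted-loop-++ v w loop-v = mk⇔ (subst Accepting (run-loop-++ v w loop-v)) (subst Accepting (sym (run-loop-++ v w loop-v)))
    where
    Accepting : State → Set
    Accepting q′ = final q′ ≡ true

  Useful : State → Set
  Useful q = Reachable q × ∃[ w ] AcceptedFrom q w

  LoopsCommute : Set
  LoopsCommute = ∀ q → Useful q → ∀ x y → Loop q x → Loop q y → x ++ y ≡ y ++ x

  NeverReturns : State → Word → Set
  NeverReturns q r = ∀ r₁ r₂ → r ≡ r₁ ++ r₂ → 0 < length r₁ → run M q r₁ ≢ q

  NeverVisits : State → State → Word → Set
  NeverVisits q s w = ∀ r₁ r₂ → w ≡ r₁ ++ r₂ → run M s r₁ ≢ q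

  last-visit : ∀ q s w → (∃[ v ] ∃[ r ] (w ≡ v ++ r × run M s v ≡ q × NeverReturns q r)) ⊎ NeverVisits q s w
  last-visit q s [] with s ≟ q
  ... | yes s≡q = inj₁ ([] , [] , refl , s≡q , λ { [] _ _ () ; (_ ∷ _) _ () _ })
  ... | no  s≢q = inj₂ λ { [] _ _ → s≢q ; (_ ∷ _) _ () }
  last-visit q s (a ∷ w) with last-visit q (δ s a) w
  ... | inj₁ (v , r , w≡vr , reaches , never) = inj₁ (a ∷ v , r , cong (a ∷_) w≡vr , reaches , never)
  ... | inj₂ never with s ≟ q
  ...   | yes refl = inj₁ ([] , a ∷ w , refl , refl , λ { [] _ _ () ; (_ ∷ r₁) r₂ refl _ → never r₁ r₂ refl })
  ...   | no  s≢q  = inj₂ λ { [] _ _ → s≢q ; (_ ∷ r₁) r₂ refl → never r₁ r₂ refl }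

  last-return : ∀ q w → ∃[ v ] ∃[ r ] (w ≡ v ++ r × Loop q v × NeverReturns q r)
  last-return q w with last-visit q q w
  ... | inj₁ split = split
  ... | inj₂ never = contradiction refl (never [] w refl)

  Visits : State → Word → List State → Set
  Visits q w qs = ∀ r₁ r₂ → w ≡ r₁ ++ r₂ → run M q r₁ ∈ qs

  visits-start : ∀ {q w qs} → Visits q w qs → q ∈ qs
  visits-start {w = w} visits = visits [] w refl

  visits-after-last-return : ∀ {q v a r qs} → Loop q v → NeverReturns q (a ∷ r) → Visits q (v ++ a ∷ r) qs →
                             Visits (δ q a) r (removeAll _≟_ q qs)
  visits-after-last-return {q} {v} {a} loop-v never visits r₁ r₂ refl =
    ∈-removeAll⁺ _≟_
      (subst (_∈ _) (run-loop-++ v (a ∷ r₁) loop-v) (visits (v ++ a ∷ r₁) r₂ (sym (++-assoc v (a ∷ r₁) r₂))))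
      (never (a ∷ r₁) r₂ refl (s≤s z≤n))

module CommutingLoops {k : ℕ} (M : DFA k) (loops-commute : Automaton.LoopsCommute M) where

  open Automaton M
  open DFA M

  -- The shortest loop z commutes with y and is not longer, so it is a prefix of y.
  shortestLoop-prefix : ∀ {q} → Useful q → ∀ y → Loop q y → 0 < length y →
                        ∃[ t ] (y ≡ shortestLoop q ++ t × Loop q t × length t < length y)
  shortestLoop-prefix {q} useful y loop 0<|y| with shortestLoop-shortest q y loop 0<|y|
  ... | 0<|z| , |z|≤|y|
    with ++-prefix (shortestLoop q) y y (shortestLoop q) (loops-commute q useful _ y (shortestLoop-loop q) loop) |z|≤|y|
  ... | t , refl = t , refl , loop-suffix (shortestLoop q) t (shortestLoop-loop q) loop ,
                   subst (length t <_) (sym (length-++ (shortestLoop q))) (m<n+m (length t) 0<|z|)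

  loop-is-power : ∀ {q} → Useful q → ∀ y → Loop q y → ∃[ e ] y ≡ power (shortestLoop q) e
  loop-is-power {q} useful y = go (length y) y ≤-refl
    where
    go : ∀ n y → length y ≤ n → Loop q y → ∃[ e ] y ≡ power (shortestLoop q) e
    go n       []      _     _    = 0 , refl
    go (suc n) (a ∷ y) |y|≤n loop with shortestLoop-prefix useful (a ∷ y) loop (s≤s z≤n)
    ... | t , y≡zt , loop-t , |t|<|y| with go n t (m<1+n⇒m≤n (<-≤-trans |t|<|y| |y|≤n)) loop-t
    ...   | e , t≡zᵉ = suc e , trans y≡zt (cong (shortestLoop q ++_) t≡zᵉ)

  loopPattern : State → Word → BoundedLanguage (Fin k)
  loopPattern q []      = if final q then starᴮ (shortestLoop q) else ∅ᴮ
  loopPattern q (a ∷ u) = starᴮ (shortestLoop q) ·ᴮ (wordᴮ (a ∷ []) ·ᴮ loopPattern (δ q a) u)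

  SomeWord-loopPattern-[] : ∀ q {P : Word → Set p} →
                        SomeWord (loopPattern q []) P ⇔ (final q ≡ true × ∃[ e ] P (power (shortestLoop q) e))
  SomeWord-loopPattern-[] q {P = P} with final q
  ... | true  = mk⇔ (λ w → refl , to (SomeWord-star _ {P = P}) w) (λ (_ , w) → from (SomeWord-star _ {P = P}) w)
  ... | false = mk⇔ (⊥-elim ∘ SomeWord-∅ {P = P}) (λ ())

  SomeWord-loopPattern-∷ : ∀ q a u {P : Word → Set p} →
                       SomeWord (loopPattern q (a ∷ u)) P ⇔
                       (∃[ e ] SomeWord (loopPattern (δ q a) u) (λ τ → P (power (shortestLoop q) e ++ a ∷ τ)))
  SomeWord-loopPattern-∷ q a u {P = P} = mk⇔
    (λ w → let e , w′ = to (SomeWord-star z {P = After}) (to (SomeWord-· (starᴮ z) rest {P}) w)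
           in e , to (SomeWord-word (a ∷ []) {P = Tail e}) (to (SomeWord-· (wordᴮ (a ∷ [])) next {P ∘ (power z e ++_)}) w′))
    (λ (e , w) → from (SomeWord-· (starᴮ z) rest {P}) (from (SomeWord-star z {P = After})
                   (e , from (SomeWord-· (wordᴮ (a ∷ [])) next {P ∘ (power z e ++_)}) (from (SomeWord-word (a ∷ []) {P = Tail e}) w))))
    where
    z = shortestLoop q
    next = loopPattern (δ q a) u
    rest = wordᴮ (a ∷ []) ·ᴮ next
    After : Word → Set _
    After σ = SomeWord rest (λ τ → P (σ ++ τ))
    Tail : ℕ → Word → Set _
    Tail e σ = SomeWord next (λ τ → P (power z e ++ (σ ++ τ)))

  loopPattern-sound : ∀ q u {P : Word → Set p} → SomeWord (loopPattern q u) P → ∃[ w ] (P w × AcceptedFrom q w)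
  loopPattern-sound q [] {P = P} w with to (SomeWord-loopPattern-[] q {P = P}) w
  ... | final-q , e , pe = power (shortestLoop q) e , pe ,
        trans (cong final (loop-power (shortestLoop q) (shortestLoop-loop q) e)) final-q
  loopPattern-sound q (a ∷ u) {P = P} w with to (SomeWord-loopPattern-∷ q a u {P = P}) w
  ... | e , w′ with loopPattern-sound (δ q a) u w′
  ...   | τ , pτ , accepted = power (shortestLoop q) e ++ a ∷ τ , pτ ,
          from (accepted-loop-++ (power (shortestLoop q) e) (a ∷ τ) (loop-power _ (shortestLoop-loop q) e)) accepted

  -- Induction on the set of states the run may visit: after the last return to q it avoids q.
  loopPattern-complete : ∀ n qs → length qs ≤ n → ∀ q w → Reachable q → AcceptedFrom q w → Visits q w qs →
                         ∃[ u ] (length u < length qs × SomeWord (loopPattern q u) (_≡ w))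
  loopPattern-complete zero qs |qs|≤0 q w _ _ visits =
    contradiction (≤-trans (∈-length (visits-start visits)) |qs|≤0) λ ()
  loopPattern-complete (suc n) qs |qs|≤1+n q w reachable accepted visits
    with last-return q w
  ... | v , r , refl , loop-v , never
    with loop-is-power (reachable , v ++ r , accepted) v loop-v
  ... | e , v≡zᵉ with r
  ...   | [] = [] , ∈-length (visits-start visits) ,
               from (SomeWord-loopPattern-[] q {P = _≡ v ++ []})
                    (to (accepted-loop-++ v [] loop-v) accepted , e , sym (trans (++-identityʳ v) v≡zᵉ))
  ...   | a ∷ r′
    with loopPattern-complete n (removeAll _≟_ q qs)
           (m<1+n⇒m≤n (<-≤-trans (removeAll-shorter _≟_ (visits-start visits)) |qs|≤1+n)) (δ q a) r′
           (reachable-run reachable (a ∷ [])) (to (accepted-loop-++ v (a ∷ r′) loop-v) accepted)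
           (visits-after-last-return loop-v never visits)
  ...     | u , |u|<|qs′| , word-r′ =
    a ∷ u , <-≤-trans (s≤s |u|<|qs′|) (removeAll-shorter _≟_ (visits-start visits)) ,
    from (SomeWord-loopPattern-∷ q a u {P = _≡ v ++ a ∷ r′})
         (e , SomeWord-mono (loopPattern (δ q a) u) {Q = λ τ → power (shortestLoop q) e ++ a ∷ τ ≡ v ++ a ∷ r′}
                (λ τ τ≡r′ → cong₂ _++_ (sym v≡zᵉ) (cong (a ∷_) τ≡r′)) word-r′)

  shortWords : List Word
  shortWords = concatMap (words k) (upTo (suc nStates))

  ∈-shortWords : ∀ u → length u ≤ nStates → u ∈ shortWords
  ∈-shortWords u |u|≤N = ∈-concatMap⁺ (words k) (lose (∈-upTo⁺ (s≤s |u|≤N)) (∈-words u))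

  acceptedᴮ : BoundedLanguage (Fin k)
  acceptedᴮ = ⋃ᴮ (map (loopPattern start) shortWords)

  accepts⇔acceptedᴮ : ∀ w → Accepts M w ⇔ SomeWord acceptedᴮ (_≡ w)
  accepts⇔acceptedᴮ w = mk⇔ complete sound
    where
    some-pattern : SomeWord acceptedᴮ (_≡ w) ⇔ Any (λ u → SomeWord (loopPattern start u) (_≡ w)) shortWords
    some-pattern = mk⇔ (Any.map⁻ ∘ to (SomeWord-⋃ (map (loopPattern start) shortWords) {P = _≡ w}))
                       (from (SomeWord-⋃ (map (loopPattern start) shortWords) {P = _≡ w}) ∘ Any.map⁺)
    complete : Accepts M w → SomeWord acceptedᴮ (_≡ w)
    complete accepted
      with u , |u|<N , word-w ← loopPattern-complete nStates (allFin nStates) (≤-reflexive (length-tabulate (λ i → i)))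
                                  start w ([] , refl) accepted (λ _ _ _ → ∈-allFin _)
      = from some-pattern (lose (∈-shortWords u (<⇒≤ (subst (length u <_) (length-tabulate (λ i → i)) |u|<N))) word-w)
    sound : SomeWord acceptedᴮ (_≡ w) → Accepts M w
    sound word-w with find (to some-pattern word-w)
    ... | u , _ , word-w′ with loopPattern-sound start u {P = _≡ w} word-w′
    ...   | _ , refl , accepted = accepted

module _ {k : ℕ} (M : DFA k) where

  open Automaton M
  open DFA M

  distinct-accepted≤countUpTo : ∀ {ws L} → Unique ws → (∀ {w} → w ∈ ws → Accepts M w × length w ≡ L) →
                                length ws ≤ countUpTo M L
  distinct-accepted≤countUpTo {ws} {L} unique accepted = ≤-trans
    (Unique⇒length≤ unique λ {w} w∈ws → let acc , |w|≡L = accepted w∈ws in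
      ∈-filter⁺ (T? ∘ acceptsᵇ M) (subst (λ n → w ∈ words k n) |w|≡L (∈-words w)) (subst T (sym acc) tt))
    (∈⇒≤sum (∈-map⁺ (λ n → length (filterᵇ (acceptsᵇ M) (words k n))) (∈-upTo⁺ (n<1+n L))))

  module NoncommutingLoops {q} (p s x y : Word) (reaches : run M start p ≡ q) (accepted : AcceptedFrom q s)
                           (loop-x : Loop q x) (loop-y : Loop q y) (xy≢yx : x ++ y ≢ y ++ x) where

    ℓ : ℕ
    ℓ = suc (proj₁ (noncommuting-nonempty x y xy≢yx))

    block : Bool → Word
    block true  = x ++ y
    block false = y ++ x

    length-block : ∀ b → length (block b) ≡ ℓ
    length-block true  = proj₂ (noncommuting-nonempty x y xy≢yx)
    length-block false = trans (length-++-comm y x) (length-block true)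

    block-injective : Injective _≡_ _≡_ block
    block-injective {true}  {true}  _  = refl
    block-injective {false} {false} _  = refl
    block-injective {true}  {false} eq = contradiction eq xy≢yx
    block-injective {false} {true}  eq = contradiction (sym eq) xy≢yx

    block-loop : ∀ b → Loop q (block b)
    block-loop true  = loop-++ x y loop-x loop-y
    block-loop false = loop-++ y x loop-y loop-x

    blocks-loop : ∀ bs → Loop q (concatMap block bs)
    blocks-loop []       = refl
    blocks-loop (b ∷ bs) = loop-++ (block b) _ (block-loop b) (blocks-loop bs)

    word : List Bool → Word
    word bs = p ++ (concatMap block bs ++ s)

    word-injective : Injective _≡_ _≡_ word
    word-injective {bs} {bs′} eq = concatMap-injective _ length-block block-injective
      (++-cancelʳ s (concatMap block bs) (concatMap block bs′) (++-cancelˡ p _ _ eq))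

    word-accepted : ∀ bs → Accepts M (word bs)
    word-accepted bs = trans (cong final (begin
      run M start (p ++ (concatMap block bs ++ s)) ≡⟨ run-++ start p _ ⟩
      run M (run M start p) (concatMap block bs ++ s) ≡⟨ cong (λ q′ → run M q′ (concatMap block bs ++ s)) reaches ⟩
      run M q (concatMap block bs ++ s)              ≡⟨ run-loop-++ (concatMap block bs) s (blocks-loop bs) ⟩
      run M q s                                      ∎)) accepted
      where open ≡-Reasoning

    length-word : ∀ bs → length (word bs) ≡ length p + (length bs * ℓ + length s)
    length-word bs = trans (length-++ p) (cong (length p +_)
      (trans (length-++ (concatMap block bs)) (cong (_+ length s) (length-concatMap ℓ length-block bs))))

    2^m≤count : ∀ m → 2 ^ m ≤ countUpTo M (length p + (m * ℓ + length s))
    2^m≤count m = subst (_≤ countUpTo M (length p + (m * ℓ + length s)))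
      (trans (length-map word (bitStrings m)) (length-bitStrings m))
      (distinct-accepted≤countUpTo (Unique.map⁺ word-injective (bitStrings-unique m))
                                   (λ w∈ → words-accepted (∈-map⁻ word w∈)))
      where
      words-accepted : ∀ {w} → ∃[ bs ] (bs ∈ bitStrings m × w ≡ word bs) →
                       Accepts M w × length w ≡ length p + (m * ℓ + length s)
      words-accepted (bs , bs∈ , refl) = word-accepted bs ,
        trans (length-word bs) (cong (λ n → length p + (n * ℓ + length s)) (∈-bitStrings⇒length m bs∈))

  sparse⇒loops-commute : PolyBounded M → LoopsCommute
  sparse⇒loops-commute (c , d , bound) q ((p , reaches) , s , accepted) x y loop-x loop-y
    with ≡-dec _≟_ (x ++ y) (y ++ x)
  ... | yes commute = commute
  ... | no  xy≢yx   = contradiction exponential-count (2^-not-polynomially-bounded c d (suc (length p + length s)) ℓ)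
    where
    open NoncommutingLoops p s x y reaches accepted loop-x loop-y xy≢yx
    exponential-count : ∀ m → 2 ^ m ≤ c * (suc (length p + length s) + m * ℓ) ^ d
    exponential-count m = subst (λ n → 2 ^ m ≤ c * suc n ^ d)
      (trans (cong (length p +_) (+-comm (m * ℓ) (length s))) (sym (+-assoc (length p) (length s) (m * ℓ))))
      (≤-trans (2^m≤count m) (bound _))

-- Evaluation in the group

module _ {c ℓ : Level} (G : AbelianGroup c ℓ) where

  open AbelianGroup G renaming (Carrier to Γ; refl to ≈-refl; sym to ≈-sym; trans to ≈-trans)
  open GroupDefs G
  open MonoidMorphisms rawMonoid rawMonoid using (IsMonoidHomomorphism)
  open ≈-Reasoning setoid

  iter-isMonoidHomomorphism : ∀ {E : Γ → Γ} → IsMonoidHomomorphism E → ∀ n → IsMonoidHomomorphism (iter E n)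
  iter-isMonoidHomomorphism E-homo zero    = Identity.isMonoidHomomorphism rawMonoid ≈-refl
  iter-isMonoidHomomorphism E-homo (suc n) =
    Composition.isMonoidHomomorphism ≈-trans (iter-isMonoidHomomorphism E-homo n) E-homo

  module _ {E : Γ → Γ} (E-homo : IsMonoidHomomorphism E) where

    private module E = IsMonoidHomomorphism E-homo

    evalFrom-suc : ∀ i σ → evalFrom E (suc i) σ ≈ E (evalFrom E i σ)
    evalFrom-suc i []      = ≈-sym E.ε-homo
    evalFrom-suc i (s ∷ σ) = begin
      E (iter E i s) ∙ evalFrom E (suc (suc i)) σ ≈⟨ ∙-congˡ (evalFrom-suc (suc i) σ) ⟩
      E (iter E i s) ∙ E (evalFrom E (suc i) σ)   ≈⟨ E.homo _ _ ⟨
      E (iter E i s ∙ evalFrom E (suc i) σ)       ∎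

    evalFrom-iter : ∀ n σ → evalFrom E n σ ≈ iter E n ⟦ σ ⟧[ E ]
    evalFrom-iter zero    σ = ≈-refl
    evalFrom-iter (suc n) σ = ≈-trans (evalFrom-suc n σ) (E.⟦⟧-cong (evalFrom-iter n σ))

    evalFrom-zeros-++ : ∀ n j σ → evalFrom E j (replicate n ε ++ σ) ≈ evalFrom E (n + j) σ
    evalFrom-zeros-++ zero    j σ = ≈-refl
    evalFrom-zeros-++ (suc n) j σ = begin
      iter E j ε ∙ evalFrom E (suc j) (replicate n ε ++ σ) ≈⟨ ∙-cong Eʲ.ε-homo (evalFrom-zeros-++ n (suc j) σ) ⟩
      ε ∙ evalFrom E (n + suc j) σ                         ≈⟨ identityˡ _ ⟩
      evalFrom E (n + suc j) σ                             ≡⟨ cong (λ i → evalFrom E i σ) (+-suc n j) ⟩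
      evalFrom E (suc n + j) σ                             ∎
      where module Eʲ = IsMonoidHomomorphism (iter-isMonoidHomomorphism E-homo j)

  padding : ∀ {F} → IsMonoidHomomorphism F → ∀ r′ σ →
            ⟦ concatMap (λ g → g ∷ replicate r′ ε) σ ⟧[ F ] ≈ ⟦ σ ⟧[ iter F (suc r′) ]
  padding             F-homo r′ []      = ≈-refl
  padding {F = F} F-homo r′ (g ∷ σ) = begin
    g ∙ evalFrom F 1 (replicate r′ ε ++ padded) ≈⟨ ∙-congˡ (evalFrom-zeros-++ F-homo r′ 1 padded) ⟩
    g ∙ evalFrom F (r′ + 1) padded              ≡⟨ cong (λ i → g ∙ evalFrom F i padded) (+-comm r′ 1) ⟩
    g ∙ evalFrom F (suc r′) padded              ≈⟨ ∙-congˡ (evalFrom-iter F-homo (suc r′) padded) ⟩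
    g ∙ iter F (suc r′) ⟦ padded ⟧[ F ]         ≈⟨ ∙-congˡ (Fʳ.⟦⟧-cong (padding F-homo r′ σ)) ⟩
    g ∙ iter F (suc r′) ⟦ σ ⟧[ iter F (suc r′) ] ≈⟨ ∙-congˡ (evalFrom-suc Fʳ-homo 0 σ) ⟨
    g ∙ evalFrom (iter F (suc r′)) 1 σ          ∎
    where
    padded = concatMap (λ g → g ∷ replicate r′ ε) σ
    Fʳ-homo = iter-isMonoidHomomorphism F-homo (suc r′)
    module Fʳ = IsMonoidHomomorphism Fʳ-homo

  module _ (F : Γ → Γ) where

    EvaluatesTo : Γ → List Γ → Set ℓ
    EvaluatesTo a σ = ⟦ σ ⟧[ F ] ≈ a

    Represents : BoundedLanguage Γ → Pred Γ p → Set _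
    Represents B A = ∀ a → A a ⇔ SomeWord B (EvaluatesTo a)

    SomeWord-bounded : ∀ {n} (s : Fin n → List Γ) (φ : Formula n) {P : List Γ → Set p} →
                       SomeWord (bounded n s φ) P ⇔ (∃[ k ] (Sat φ k × P (tuplePow s k)))
    SomeWord-bounded s φ {P = P} = mk⇔
      (λ (k , sat , pk) → k , sat , subst P (sym (tuplePow≡tuplePower k)) pk)
      (λ (k , sat , pk) → k , sat , subst P (tuplePow≡tuplePower k) pk)
      where
      tuplePow≡tuplePower : ∀ k → tuplePow s k ≡ tuplePower s k
      tuplePow≡tuplePower k = cong concat (map-tabulate (λ i → i) (λ i → power (s i) (k i)))

    IsEDP⇔represented : {A : Pred Γ p} → IsEDP F A ⇔ (∃[ B ] Represents B A)
    IsEDP⇔represented = mk⇔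
      (λ (n , s , φ , edp) → bounded n s φ , λ a → mk⇔ (from (SomeWord-bounded s φ {P = EvaluatesTo a}) ∘ proj₁ (edp a))
                                                       (proj₂ (edp a) ∘ to (SomeWord-bounded s φ {P = EvaluatesTo a})))
      (λ (bounded n s φ , rep) → n , s , φ , λ a → to (SomeWord-bounded s φ {P = EvaluatesTo a}) ∘ to (rep a) ,
                                                   from (rep a) ∘ from (SomeWord-bounded s φ {P = EvaluatesTo a}))

    represented-⋃ : ∀ {m} {A : Fin m → Pred Γ p} (B : Fin m → BoundedLanguage Γ) →
                    (∀ i → Represents (B i) (A i)) → Represents (⋃ᴮ (tabulate B)) (⋃ A)
    represented-⋃ B rep a = mk⇔
      (λ (i , Aᵢa) → from (SomeWord-⋃ (tabulate B) {P = EvaluatesTo a}) (Any.tabulate⁺ i (to (rep i a) Aᵢa)))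
      (λ w → let i , wᵢ = Any.tabulate⁻ (to (SomeWord-⋃ (tabulate B) {P = EvaluatesTo a}) w) in i , from (rep i a) wᵢ)

    IsEDP-⋃ : ∀ m (A : Fin m → Pred Γ p) → (∀ i → IsEDP F (A i)) → IsEDP F (⋃ A)
    IsEDP-⋃ m A edp = from IsEDP⇔represented (_ , represented-⋃ (proj₁ ∘ represented) (proj₂ ∘ represented))
      where
      represented = λ i → to IsEDP⇔represented (edp i)

  IsSparseSet⇒IsEDP : ∀ {F} {A : Pred Γ p} → IsMonoidHomomorphism F → IsSparseSet F A → IsEDP F A
  IsSparseSet⇒IsEDP {F = F} {A = A} F-homo (suc r′ , _ , k , S , _ , M , poly , sparse) =
    from (IsEDP⇔represented F) (imageᴮ pad acceptedᴮ , represented)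
    where
    open CommutingLoops M (sparse⇒loops-commute M poly) using (acceptedᴮ; accepts⇔acceptedᴮ)
    pad : Fin k → List Γ
    pad i = S i ∷ replicate r′ ε
    eval-pad : ∀ w → ⟦ concatMap pad w ⟧[ F ] ≈ ⟦ map S w ⟧[ iter F (suc r′) ]
    eval-pad w =
      subst (λ σ → ⟦ σ ⟧[ F ] ≈ ⟦ map S w ⟧[ iter F (suc r′) ]) (concatMap-map _ S w) (padding F-homo r′ (map S w))
    represented : Represents F (imageᴮ pad acceptedᴮ) A
    represented a =
      ⇔-sym (SomeWord-witness acceptedᴮ ⇔-∘ SomeWord-image pad acceptedᴮ {P = EvaluatesTo F a}) ⇔-∘ (accepted⇔ ⇔-∘ sparse⇔)
      where
      sparse⇔ : A a ⇔ (∃[ w ] (Accepts M w × ⟦ map S w ⟧[ iter F (suc r′) ] ≈ a))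
      sparse⇔ = mk⇔ (proj₁ (sparse a)) (proj₂ (sparse a))
      accepted⇔ : (∃[ w ] (Accepts M w × ⟦ map S w ⟧[ iter F (suc r′) ] ≈ a)) ⇔
                  (∃[ w ] (SomeWord acceptedᴮ (_≡ w) × EvaluatesTo F a (concatMap pad w)))
      accepted⇔ = mk⇔
        (λ (w , accepted , val) → w , to (accepts⇔acceptedᴮ w) accepted , ≈-trans (eval-pad w) val)
        (λ (w , word-w , val) → w , from (accepts⇔acceptedᴮ w) word-w , ≈-trans (≈-sym (eval-pad w)) val)

lemma7p2 : {c ℓ p : Level} (G : AbelianGroup c ℓ) → GroupDefs.Infinite G →
           (F : AbelianGroup.Carrier G → AbelianGroup.Carrier G) →
           GroupDefs.IsGroupMonomorphism G F →
           ((m : ℕ) (A : Fin m → Pred (AbelianGroup.Carrier G) p) →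
              ((i : Fin m) → GroupDefs.IsEDP G F (A i)) →
              GroupDefs.IsEDP G F (GroupDefs.⋃ G A))
           × ((A : Pred (AbelianGroup.Carrier G) p) →
              GroupDefs.IsSparseSet G F A → GroupDefs.IsEDP G F A)
lemma7p2 G _ F F-mono = IsEDP-⋃ G F , λ A → IsSparseSet⇒IsEDP G (IsGroupMonomorphism.isMonoidHomomorphism F-mono)
  where open GroupDefs G using (module IsGroupMonomorphism)
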